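{- For $n\ge1$ and every formal power series $f$ in $x$, $$(xD_q)^nf=\sum_{k=1}^nS_q(n,k)\,x^k\,f_k^{(n-k)}.$$
   Context: $D_qh(x)=\frac{h(x)-h(xq)}{x-xq}$; $(xD_q)$ is the operator $h\mapsto x\,D_qh$. $f_k^{(j)}(x)=(D_q^kf)(q^jx)$. The $q$-Stirling numbers of the second kind are defined by $S_q(0,0)=1$, $S_q(0,k)=0$ for $k\ne0$, and $S_q(n,k)=q^{n-k}S_q(n-1,k-1)+[k]_qS_q(n-1,k)$ for $n\ge1$, with $[k]_q=1+q+\dots+q^{k-1}$. -}

module Defs where

open import Level using (Level)
open import Data.Nat using (ℕ; zero; suc; _∸_)
open import Algebra.Bundles using (CommutativeRing)

-- Formal power series in x over a commutative ring R, with a fixed q ∈ R.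
-- A power series is its coefficient sequence: f m = coefficient of x^m.
module QCalc {c ℓ : Level} (R : CommutativeRing c ℓ) (q : CommutativeRing.Carrier R) where
  open CommutativeRing R using (Carrier; _+_; _*_; 0#; 1#)

  PS : Set c
  PS = ℕ → Carrier

  pow : Carrier → ℕ → Carrier
  pow a zero    = 1#
  pow a (suc n) = a * pow a n

  qint : ℕ → Carrier
  qint zero    = 0#
  qint (suc k) = qint k + pow q k

  -- q-derivative on formal power series:
  -- D_q h = (h(x) - h(qx)) / (x - qx), i.e. D_q x^(m+1) = [m+1]_q x^m
  Dq : PS → PS
  Dq h m = qint (suc m) * h (suc m)

  -- dilation  h ↦ h(a x)
  dil : Carrier → PS → PS
  dil a h m = pow a m * h m

  xmul : PS → PS
  xmul h zero    = 0#
  xmul h (suc m) = h m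

  xpow : ℕ → PS → PS
  xpow zero    h = h
  xpow (suc k) h = xmul (xpow k h)

  xDq : PS → PS
  xDq h = xmul (Dq h)

  iter : (PS → PS) → ℕ → PS → PS
  iter T zero    h = h
  iter T (suc n) h = T (iter T n h)

  -- f_k^{(j)}(x) = (D_q^k f)(q^j x)
  fkj : PS → ℕ → ℕ → PS
  fkj f k j = dil (pow q j) (iter Dq k f)

  -- q-Stirling numbers of the second kind (S_q(n,-1) read as 0)
  Sq : ℕ → ℕ → Carrier
  Sq zero    zero    = 1#
  Sq zero    (suc k) = 0#
  Sq (suc n) zero    = qint zero * Sq n zero
  Sq (suc n) (suc k) = pow q (n ∸ k) * Sq n k + qint (suc k) * Sq n (suc k)

  sum1 : (ℕ → Carrier) → ℕ → Carrier
  sum1 g zero    = 0#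
  sum1 g (suc n) = sum1 g n + g (suc n)

-- On coefficients, x D_q is diagonal: it multiplies the coefficient of x^m by [m]_q.  From this one
-- reads off the q-product rule
--   x D_q (x^k g(a x)) = a x^(k+1) (D_q g)(a x) + [k]_q x^k g(q a x),
-- which follows from [k + j]_q = [j]_q + q^j [k]_q.  Applied to x^k f_k^(n-k) it gives
--   x D_q (x^k f_k^(n-k)) = q^(n-k) x^(k+1) f_(k+1)^(n-k) + [k]_q x^k f_k^(n+1-k),
-- and regrouping the sum by powers of x is exactly the recurrence defining S_q, so the expansion
-- (with a k = 0 term, which makes n = 0 the base case) follows by induction on n.
module Submission where

open import Defs
open import Level using (Level)
open import Data.Nat using (ℕ; zero; suc; _≤_; _<_; _∸_; s≤s; z≤n) renaming (_+_ to _+ℕ_)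
open import Algebra.Bundles using (CommutativeRing)
import Data.Nat.Properties as ℕ
open import Function using (_∘_)
open import Relation.Binary.PropositionalEquality as ≡ using (_≡_; refl)
import Algebra.Properties.CommutativeSemigroup as CommutativeSemigroupProperties
import Relation.Binary.Reasoning.Setoid as SetoidReasoning

module QCalcProperties {c ℓ : Level} (R : CommutativeRing c ℓ) (q : CommutativeRing.Carrier R) where
  open CommutativeRing R hiding (refl; zero)
  open QCalc R q
  open CommutativeSemigroupProperties *-commutativeSemigroup
    using (interchange; x∙yz≈y∙xz; x∙yz≈yx∙z; xy∙z≈y∙xz)
  open CommutativeSemigroupProperties +-commutativeSemigroup using () renaming (interchange to +-interchange)
  open SetoidReasoning setoid

  infix 4 _≗_
  _≗_ : PS → PS → Set ℓ
  g ≗ h = ∀ m → g m ≈ h m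

  pow-1# : ∀ n → pow 1# n ≈ 1#
  pow-1# zero    = CommutativeRing.refl R
  pow-1# (suc n) = trans (*-identityˡ _) (pow-1# n)

  pow-distrib-* : ∀ a b n → pow (a * b) n ≈ pow a n * pow b n
  pow-distrib-* a b zero    = sym (*-identityˡ 1#)
  pow-distrib-* a b (suc n) = trans (*-congˡ (pow-distrib-* a b n)) (interchange a b _ _)

  pow-+ : ∀ a m n → pow a (m +ℕ n) ≈ pow a m * pow a n
  pow-+ a zero    n = sym (*-identityˡ _)
  pow-+ a (suc m) n = trans (*-congˡ (pow-+ a m n)) (sym (*-assoc a _ _))

  qint-+ : ∀ m n → qint (m +ℕ n) ≈ qint m + pow q m * qint n
  qint-+ m zero rewrite ℕ.+-identityʳ m = sym (trans (+-congˡ (zeroʳ _)) (+-identityʳ _))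
  qint-+ m (suc n) rewrite ℕ.+-suc m n = begin
    qint (m +ℕ n) + pow q (m +ℕ n)                  ≈⟨ +-cong (qint-+ m n) (pow-+ q m n) ⟩
    (qint m + pow q m * qint n) + pow q m * pow q n ≈⟨ +-assoc _ _ _ ⟩
    qint m + (pow q m * qint n + pow q m * pow q n) ≈⟨ +-congˡ (sym (distribˡ _ _ _)) ⟩
    qint m + pow q m * (qint n + pow q n)           ∎

  data Split (k : ℕ) : ℕ → Set where
    below : ∀ {m} → m < k → Split k m
    above : ∀ j → Split k (k +ℕ j)

  split : ∀ k m → Split k m
  split zero    m       = above m
  split (suc k) zero    = below (s≤s z≤n)
  split (suc k) (suc m) with split k m
  ... | below m<k = below (s≤s m<k)
  ... | above j   = above j

  xpow-below : ∀ k h {m} → m < k → xpow k h m ≡ 0#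
  xpow-below (suc k) h {zero}  _         = refl
  xpow-below (suc k) h {suc m} (s≤s m<k) = xpow-below k h m<k

  xpow-+ : ∀ k h j → xpow k h (k +ℕ j) ≡ h j
  xpow-+ zero    h j = refl
  xpow-+ (suc k) h j = xpow-+ k h j

  xpow-suc-+ : ∀ k h j → xpow (suc k) h (k +ℕ suc j) ≡ h j
  xpow-suc-+ k h j rewrite ℕ.+-suc k j = xpow-+ k h j

  xDq-coeff : ∀ h m → xDq h m ≈ qint m * h m
  xDq-coeff h zero    = sym (zeroˡ _)
  xDq-coeff h (suc m) = CommutativeRing.refl R

  xDq-cong : ∀ {g h} → g ≗ h → xDq g ≗ xDq h
  xDq-cong g≗h zero    = CommutativeRing.refl R
  xDq-cong g≗h (suc m) = *-congˡ (g≗h (suc m))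

  xDq-xpow-dil : ∀ k a g →
    xDq (xpow k (dil a g)) ≗ λ m → a * xpow (suc k) (dil a (Dq g)) m + qint k * xpow k (dil (q * a) g) m
  xDq-xpow-dil k a g m = trans (xDq-coeff (xpow k (dil a g)) m) (coeff (split k m))
    where
    coeff : ∀ {m} → Split k m →
      qint m * xpow k (dil a g) m ≈ a * xpow (suc k) (dil a (Dq g)) m + qint k * xpow k (dil (q * a) g) m
    coeff (below m<k)
      rewrite xpow-below k (dil a g) m<k
            | xpow-below (suc k) (dil a (Dq g)) (ℕ.m≤n⇒m≤1+n m<k)
            | xpow-below k (dil (q * a) g) m<k
      = trans (zeroʳ _) (sym (trans (+-cong (zeroʳ a) (zeroʳ _)) (+-identityʳ 0#)))
    coeff (above zero)
      rewrite xpow-+ k (dil a g) 0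
            | xpow-+ k (dil (q * a) g) 0
            | xpow-below (suc k) (dil a (Dq g)) (s≤s (ℕ.≤-reflexive (ℕ.+-identityʳ k)))
            | ℕ.+-identityʳ k
      = sym (trans (+-congʳ (zeroʳ a)) (+-identityˡ _))
    coeff (above (suc j))
      rewrite xpow-+ k (dil a g) (suc j)
            | xpow-+ k (dil (q * a) g) (suc j)
            | xpow-suc-+ k (dil a (Dq g)) j
      = begin
        qint (k +ℕ J) * (pow a J * G)
          ≈⟨ *-congʳ (trans (reflexive (≡.cong qint (ℕ.+-comm k J))) (qint-+ J k)) ⟩
        (qint J + pow q J * qint k) * (pow a J * G)
          ≈⟨ distribʳ _ _ _ ⟩
        qint J * (pow a J * G) + (pow q J * qint k) * (pow a J * G)
          ≈⟨ +-cong (trans (x∙yz≈y∙xz _ _ _) (*-assoc _ _ _))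
                    (trans (xy∙z≈y∙xz _ _ _) (*-congˡ (sym (*-assoc _ _ _)))) ⟩
        a * (pow a j * (qint J * G)) + qint k * ((pow q J * pow a J) * G)
          ≈⟨ +-congˡ (*-congˡ (*-congʳ (sym (pow-distrib-* q a J)))) ⟩
        a * (pow a j * (qint J * G)) + qint k * (pow (q * a) J * G)
          ∎
      where
      J : ℕ
      J = suc j
      G : Carrier
      G = g J

  sum0 : (ℕ → Carrier) → ℕ → Carrier
  sum0 g zero    = g zero
  sum0 g (suc n) = sum0 g n + g (suc n)

  sum0-cong : ∀ {g h} n → (∀ k → k ≤ n → g k ≈ h k) → sum0 g n ≈ sum0 h n
  sum0-cong zero    g≈h = g≈h zero z≤n
  sum0-cong (suc n) g≈h = +-cong (sum0-cong n (λ k → g≈h k ∘ ℕ.m≤n⇒m≤1+n)) (g≈h (suc n) ℕ.≤-refl)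

  sum0-distrib-+ : ∀ g h n → sum0 (λ k → g k + h k) n ≈ sum0 g n + sum0 h n
  sum0-distrib-+ g h zero    = CommutativeRing.refl R
  sum0-distrib-+ g h (suc n) = trans (+-congʳ (sum0-distrib-+ g h n)) (+-interchange _ _ _ _)

  *-distribˡ-sum0 : ∀ a g n → a * sum0 g n ≈ sum0 (λ k → a * g k) n
  *-distribˡ-sum0 a g zero    = CommutativeRing.refl R
  *-distribˡ-sum0 a g (suc n) = trans (distribˡ _ _ _) (+-congʳ (*-distribˡ-sum0 a g n))

  sum0≈sum1 : ∀ g n → g 0 ≈ 0# → sum0 g n ≈ sum1 g n
  sum0≈sum1 g zero    g0≈0 = g0≈0
  sum0≈sum1 g (suc n) g0≈0 = +-congʳ (sum0≈sum1 g n g0≈0)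

  sum1-suc≈sum0 : ∀ g n → sum1 g (suc n) ≈ sum0 (g ∘ suc) n
  sum1-suc≈sum0 g zero    = +-identityˡ _
  sum1-suc≈sum0 g (suc n) = +-congʳ (sum1-suc≈sum0 g n)

  xDq-sum0 : ∀ (s : ℕ → Carrier) (F : ℕ → PS) n →
    xDq (λ m → sum0 (λ k → s k * F k m) n) ≗ λ m → sum0 (λ k → s k * xDq (F k) m) n
  xDq-sum0 s F n m = begin
    xDq (λ m → sum0 (λ k → s k * F k m) n) m ≈⟨ xDq-coeff (λ m → sum0 (λ k → s k * F k m) n) m ⟩
    qint m * sum0 (λ k → s k * F k m) n      ≈⟨ *-distribˡ-sum0 _ _ n ⟩
    sum0 (λ k → qint m * (s k * F k m)) n    ≈⟨ sum0-cong n (λ k _ → swap-xDq k) ⟩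
    sum0 (λ k → s k * xDq (F k) m) n         ∎
    where
    swap-xDq : ∀ k → qint m * (s k * F k m) ≈ s k * xDq (F k) m
    swap-xDq k = trans (x∙yz≈y∙xz _ _ _) (*-congˡ (sym (xDq-coeff (F k) m)))

  Sq-above : ∀ n k → n < k → Sq n k ≈ 0#
  Sq-above zero    (suc k) _         = CommutativeRing.refl R
  Sq-above (suc n) (suc k) (s≤s n<k) = begin
    pow q (n ∸ k) * Sq n k + qint (suc k) * Sq n (suc k)
      ≈⟨ +-cong (*-congˡ (Sq-above n k n<k)) (*-congˡ (Sq-above n (suc k) (ℕ.m≤n⇒m≤1+n n<k))) ⟩
    pow q (n ∸ k) * 0# + qint (suc k) * 0#
      ≈⟨ trans (+-cong (zeroʳ _) (zeroʳ _)) (+-identityʳ 0#) ⟩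
    0# ∎

  Sq-suc-zero*≈0 : ∀ n x → Sq (suc n) 0 * x ≈ 0#
  Sq-suc-zero*≈0 n x = trans (*-congʳ (zeroˡ _)) (zeroˡ x)

  sum0-Sq-recurrence : ∀ n (a : ℕ → Carrier) →
    sum0 (λ k → Sq n k * (pow q (n ∸ k) * a (suc k) + qint k * a k)) n
      ≈ sum0 (λ k → Sq (suc n) k * a k) (suc n)
  sum0-Sq-recurrence n a = begin
    sum0 (λ k → Sq n k * (pow q (n ∸ k) * a (suc k) + qint k * a k)) n
                                                                       ≈⟨ sum0-cong n (λ k _ → distribˡ _ _ _) ⟩
    sum0 (λ k → A k + B k) n                                           ≈⟨ sum0-distrib-+ A B n ⟩
    sum0 A n + sum0 B n                                                ≈⟨ +-congˡ B-shift ⟩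
    sum0 A n + sum0 (B ∘ suc) n                                        ≈⟨ sym (sum0-distrib-+ A (B ∘ suc) n) ⟩
    sum0 (λ k → A k + B (suc k)) n                                     ≈⟨ sum0-cong n (λ k _ → Sq-step k) ⟩
    sum0 (G ∘ suc) n                                                   ≈⟨ sym (sum1-suc≈sum0 G n) ⟩
    sum1 G (suc n)                                                     ≈⟨ sym (sum0≈sum1 G (suc n) G0≈0) ⟩
    sum0 G (suc n)                                                     ∎
    where
    A B G : ℕ → Carrier
    A k = Sq n k * (pow q (n ∸ k) * a (suc k))
    B k = Sq n k * (qint k * a k)
    G k = Sq (suc n) k * a k

    G0≈0 : G 0 ≈ 0#
    G0≈0 = Sq-suc-zero*≈0 n (a 0)

    B-shift : sum0 B n ≈ sum0 (B ∘ suc) n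
    B-shift = begin
      sum0 B n           ≈⟨ sum0≈sum1 B n (trans (*-congˡ (zeroˡ _)) (zeroʳ _)) ⟩
      sum1 B n           ≈⟨ sym (+-identityʳ _) ⟩
      sum1 B n + 0#      ≈⟨ +-congˡ (sym (trans (*-congʳ (Sq-above n (suc n) ℕ.≤-refl)) (zeroˡ _))) ⟩
      sum1 B (suc n)     ≈⟨ sum1-suc≈sum0 B n ⟩
      sum0 (B ∘ suc) n   ∎

    Sq-step : ∀ k → A k + B (suc k) ≈ G (suc k)
    Sq-step k = trans (+-cong (x∙yz≈yx∙z _ _ _) (x∙yz≈yx∙z _ _ _)) (sym (distribʳ _ _ _))

  term : PS → ℕ → ℕ → PS
  term f n k = xpow k (fkj f k (n ∸ k))

  expansion : PS → ℕ → PS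
  expansion f n m = sum0 (λ k → Sq n k * term f n k m) n

  xDq-term : ∀ f {n k} → k ≤ n →
    xDq (term f n k) ≗ λ m → pow q (n ∸ k) * term f (suc n) (suc k) m + qint k * term f (suc n) k m
  xDq-term f {n} {k} k≤n rewrite ℕ.+-∸-assoc 1 k≤n = xDq-xpow-dil k (pow q (n ∸ k)) (iter Dq k f)

  iter-xDq≗expansion : ∀ f n → iter xDq n f ≗ expansion f n
  iter-xDq≗expansion f zero    m = sym (trans (*-identityˡ _) (trans (*-congʳ (pow-1# m)) (*-identityˡ _)))
  iter-xDq≗expansion f (suc n) m = begin
    xDq (iter xDq n f) m                        ≈⟨ xDq-cong (iter-xDq≗expansion f n) m ⟩
    xDq (expansion f n) m                       ≈⟨ xDq-sum0 (Sq n) (term f n) n m ⟩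
    sum0 (λ k → Sq n k * xDq (term f n k) m) n  ≈⟨ sum0-cong n (λ k k≤n → *-congˡ (xDq-term f k≤n m)) ⟩
    sum0 (λ k → Sq n k * (pow q (n ∸ k) * term f (suc n) (suc k) m + qint k * term f (suc n) k m)) n
                                                ≈⟨ sum0-Sq-recurrence n (λ k → term f (suc n) k m) ⟩
    expansion f (suc n) m                       ∎

mainTheorem13 : ∀ {c ℓ : Level} (R : CommutativeRing c ℓ) (q : CommutativeRing.Carrier R)
    (n : ℕ) → 1 ≤ n → (f : QCalc.PS R q) → (m : ℕ) →
    CommutativeRing._≈_ R (QCalc.iter R q (QCalc.xDq R q) n f m)
    (QCalc.sum1 R q (λ k → CommutativeRing._*_ R (QCalc.Sq R q n k)
    (QCalc.xpow R q k (QCalc.fkj R q f k (n ∸ k)) m)) n)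
mainTheorem13 R q (suc n) _ f m =
  trans (iter-xDq≗expansion f (suc n) m)
        (sum0≈sum1 _ (suc n) (Sq-suc-zero*≈0 n (term f (suc n) 0 m)))
  where
  open CommutativeRing R using (trans)
  open QCalcProperties R q
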